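{- Let $\mathcal{G}$ be a temporal graph with lifetime $T$, let $\omega\ge0$, and let $d$ be a positive integer. Then there exist integers $0 = t_0 < t_1 < \dots < t_\ell = T$ such that $t_j - t_{j-1} \leq 2d$ for each $1 \leq j \leq \ell$ and $$ \sum_{i=0}^{\ell-1} \widetilde{q}^{\,*}_\omega(\mathcal{G}_{[t_i+1,t_{i+1}]}) \geq \left(1 - \frac{1}{d}\right) \widetilde{q}^{\,*}_\omega(\mathcal{G}).$$
   Context: A temporal graph $\mathcal{G}=(G,\lambda)$ with lifetime $T$ consists of a simple undirected graph $G=(V,E)$ and $\lambda:E\to2^{[T]}$. Snapshots are $G_t=(V,E_t)$, $E_t=\{e: t\in\lambda(e)\}$, $m_t=|E_t|$, degrees $d_{v,t}$; $e_{G_t}(A)$ is the number of edges of $G_t$ inside $A\subseteq V$ and $\mathrm{vol}_{G_t}(A)=\sum_{v\in A}d_{v,t}$. A partition $\mathcal{A}$ of a temporal graph on timesteps $a,\dots,b$ is a function $\pi_{\mathcal{A}}:V\times\{a,\dots,b\}\to[k]$ (some $k$), inducing partitions $\mathcal{A}_t$ of $V$; its loyalty contribution is $\mathcal{L}(\mathcal{A})=\sum_{v\in V}\sum_{t=a}^{b-1}\mathbf{1}[\pi_{\mathcal{A}}(v,t)=\pi_{\mathcal{A}}(v,t+1)]$. The non-normalised temporal modularity is $\widetilde{q}_\omega(\mathcal{G},\mathcal{A})=\sum_{t}\sum_{A\in\mathcal{A}_t}\left(2e_{G_t}(A)-\frac{\mathrm{vol}_{G_t}(A)^2}{2m_t}\right)+\omega\mathcal{L}(\mathcal{A})$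 (sum over the timesteps of the graph), and $\widetilde{q}^{\,*}_\omega$ is its maximum over all partitions. For $1\le a\le b\le T$, $\mathcal{G}_{[a,b]}=(G,\lambda')$ with $\lambda'(e)=\lambda(e)\cap\{a,\dots,b\}$ is the restriction of $\mathcal{G}$ to timesteps $a,\dots,b$, whose snapshots are $G_a,\dots,G_b$.
   Formalization: The parameter ω ranges only over the nonnegative rationals, so every modularity value is rational. -}

module Defs where

open import Data.Bool using (Bool; true; false; _∧_; if_then_else_)
open import Data.Nat as ℕ using (ℕ; zero; suc; _∸_; _≤ᵇ_; _<ᵇ_; _≡ᵇ_)
open import Data.Fin using (Fin; toℕ)
open import Data.List using (List; []; _∷_; map; filter; length; upTo; allFin; concatMap; deduplicate; foldr)
open import Data.Integer using (+_)
open import Data.Rational using (ℚ; _/_; 0ℚ; _+_; _-_; _*_; _≤_)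
open import Data.Product using (Σ; _×_; _,_; proj₁; proj₂)
open import Relation.Nullary.Decidable using (T?)
open import Relation.Binary.PropositionalEquality using (_≡_; refl; cong)

-- Temporal graphs on vertex set V = Fin n with lifetime T.
-- edge u v  : {u,v} ∈ E(G)  (simple undirected graph G)
-- lab u v t : t ∈ λ({u,v})   (timesteps are 1,…,T)

record TemporalGraph (n T : ℕ) : Set where
  field
    edge        : Fin n → Fin n → Bool
    edge-sym    : ∀ u v → edge u v ≡ edge v u
    edge-irrefl : ∀ v → edge v v ≡ false
    lab         : Fin n → Fin n → ℕ → Bool
    lab-sym     : ∀ u v t → lab u v t ≡ lab v u t
    lab-edge    : ∀ u v t → lab u v t ≡ true → edge u v ≡ true
    lab-range   : ∀ u v t → lab u v t ≡ true → (1 ℕ.≤ t) × (t ℕ.≤ T)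

open TemporalGraph public

private
  ∧-true₁ : ∀ x y → (x ∧ y) ≡ true → x ≡ true
  ∧-true₁ true y p = refl

  inRange : ℕ → ℕ → ℕ → Bool
  inRange a b t = (a ≤ᵇ t) ∧ (t ≤ᵇ b)

restrict : ∀ {n T} → TemporalGraph n T → ℕ → ℕ → TemporalGraph n T
restrict G a b = record
  { edge        = edge G
  ; edge-sym    = edge-sym G
  ; edge-irrefl = edge-irrefl G
  ; lab         = λ u v t → lab G u v t ∧ inRange a b t
  ; lab-sym     = λ u v t → cong (λ x → x ∧ inRange a b t) (lab-sym G u v t)
  ; lab-edge    = λ u v t p → lab-edge G u v t (∧-true₁ _ _ p)
  ; lab-range   = λ u v t p → lab-range G u v t (∧-true₁ _ _ p)
  }

count : ∀ {A : Set} → (A → Bool) → List A → ℕ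
count p xs = length (filter (λ x → T? (p x)) xs)

pairs : (n : ℕ) → List (Fin n × Fin n)
pairs n = concatMap (λ u → map (u ,_) (filter (λ v → T? (toℕ u <ᵇ toℕ v)) (allFin n))) (allFin n)

degree : ∀ {n T} → TemporalGraph n T → ℕ → Fin n → ℕ
degree {n} G t v = count (λ u → lab G v u t) (allFin n)

numEdges : ∀ {n T} → TemporalGraph n T → ℕ → ℕ
numEdges {n} G t = count (λ p → lab G (proj₁ p) (proj₂ p) t) (pairs n)

Subset : ℕ → Set
Subset n = Fin n → Bool

edgesIn : ∀ {n T} → TemporalGraph n T → ℕ → Subset n → ℕ
edgesIn {n} G t A = count (λ p → A (proj₁ p) ∧ A (proj₂ p) ∧ lab G (proj₁ p) (proj₂ p) t) (pairs n)

sumℕ : List ℕ → ℕ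
sumℕ = foldr ℕ._+_ 0

vol : ∀ {n T} → TemporalGraph n T → ℕ → Subset n → ℕ
vol {n} G t A = sumℕ (map (degree G t) (filter (λ v → T? (A v)) (allFin n)))

sumℚ : List ℚ → ℚ
sumℚ = foldr _+_ 0ℚ

fromℕ : ℕ → ℚ
fromℕ k = + k / 1

-- vol² / (2 m_t); convention: 0 when m_t = 0 (then every volume is 0)
volSqOver2m : ℕ → ℕ → ℚ
volSqOver2m x zero    = 0ℚ
volSqOver2m x (suc k) = + (x ℕ.* x) / (2 ℕ.* suc k)

-- Partitions: π : V × timesteps → labels (labels in ℕ, i.e. [k] for any k)

Partition : ℕ → Set
Partition n = Fin n → ℕ → ℕ

labelsAt : ∀ {n} → Partition n → ℕ → List ℕ
labelsAt {n} π t = deduplicate ℕ._≟_ (map (λ v → π v t) (allFin n))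

part : ∀ {n} → Partition n → ℕ → ℕ → Subset n
part π t c v = π v t ≡ᵇ c

snapshotTerm : ∀ {n T} → TemporalGraph n T → Partition n → ℕ → ℚ
snapshotTerm G π t =
  sumℚ (map (λ c → fromℕ (2 ℕ.* edgesIn G t (part π t c))
                   - volSqOver2m (vol G t (part π t c)) (numEdges G t))
            (labelsAt π t))

range : ℕ → ℕ → List ℕ
range a b = map (a ℕ.+_) (upTo (suc b ∸ a))

loyalty : ∀ {n} → Partition n → ℕ → ℕ → ℕ
loyalty {n} π a b =
  sumℕ (map (λ v → count (λ t → π v t ≡ᵇ π v (suc t)) (map (a ℕ.+_) (upTo (b ∸ a))))
            (allFin n))

qTilde : ∀ {n T} → TemporalGraph n T → ℚ → ℕ → ℕ → Partition n → ℚ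
qTilde G ω a b π = sumℚ (map (snapshotTerm G π) (range a b)) + ω * fromℕ (loyalty π a b)

IsMaxMod : ∀ {n T} → TemporalGraph n T → ℚ → ℕ → ℕ → ℚ → Set
IsMaxMod {n} G ω a b Q = Σ (Partition n) (λ π → qTilde G ω a b π ≡ Q)
                       × ((π : Partition n) → qTilde G ω a b π ≤ Q)

sumUpTo : ℕ → (ℕ → ℚ) → ℚ
sumUpTo ℓ f = sumℚ (map f (upTo ℓ))

-- Cut the timeline into blocks of d timesteps, t_j = min(j d, T), and let ℓ = ⌈T/d⌉.
-- Restricting an optimal partition of 𝒢 to the blocks loses only the loyalty across the
-- ℓ - 1 block boundaries, at most ω n each, so q̃* ≤ Σ_i q̃*(𝒢_[t_i+1, t_{i+1}]) + ω n (ℓ - 1).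
-- Conversely, the partition with a single part at every timestep has snapshot terms
-- 2 m_t - (2 m_t)² / 2 m_t = 0 (handshake lemma) and full loyalty n (T - 1), whence
-- q̃* ≥ ω n (T - 1) ≥ d ω n (ℓ - 1). So the loss is at most q̃* / d. Blocks of length d
-- already suffice.
module Submission where

open import Defs

open import Algebra.Properties.CommutativeMonoid.Sum as FinSum using ()
open import Data.Bool using (Bool; true; false; _∧_; T)
open import Data.Bool.Properties using (∧-identityʳ; T-≡)
open import Data.Empty using (⊥-elim)
open import Data.Fin as Fin using (Fin; toℕ)
open import Data.Fin.Properties using (toℕ-injective)
open import Data.List using (List; []; _∷_; _++_; map; filter; length; upTo; applyUpTo; allFin; concatMap; tabulate; deduplicate)
open import Data.List.Properties using (filter-++; filter-all; length-++; length-filter; length-map; length-upTo; map-++; map-∘; map-cong; map-cong-local; map-tabulate; map-upTo; upTo-∷ʳ)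
open import Data.List.Relation.Unary.All as All using (All)
open import Data.List.Relation.Unary.All.Properties using (applyUpTo⁺₁)
open import Data.Nat as ℕ using (ℕ; zero; suc; _<ᵇ_; _∸_; _<_; NonZero)
open import Data.Nat.ListAction using (sum)
open import Data.Nat.Properties as ℕ using (+-0-commutativeMonoid; *-commutativeSemigroup)
import Data.Nat.Tactic.RingSolver as ℕ
open import Algebra.Properties.CommutativeSemigroup *-commutativeSemigroup using (x∙yz≈y∙xz)
open import Data.Integer as ℤ using (+_)
import Data.Integer.Properties as ℤ
import Data.Integer.Tactic.RingSolver as ℤ
import Data.Rational as ℚ
open import Data.Rational using (ℚ; 0ℚ; 1ℚ; _/_; _+_; _-_; -_; _*_; _≤_; toℚᵘ)
open import Data.Rational.Properties using (toℚᵘ-injective; toℚᵘ-fromℚᵘ; toℚᵘ-homo-+; toℚᵘ-homo-*; nonNegative⁻¹; normalize-nonNeg; +-identityˡ; +-identityʳ; +-assoc; +-inverseʳ; *-identityˡ; *-assoc; *-zeroʳ; *-distribˡ-+; ≤-refl; ≤-reflexive; ≤-trans; +-mono-≤; +-monoˡ-≤; +-monoʳ-≤; *-monoˡ-≤-nonNeg; neg-antimono-≤; module ≤-Reasoning)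
open import Data.Rational.Solver using (module +-*-Solver)
open import Data.Rational.Unnormalised as ℚᵘ using (mkℚᵘ; *≡*)
import Data.Rational.Unnormalised.Properties as ℚᵘ
open import Data.Product using (Σ; _×_; _,_; proj₁; proj₂)
open import Data.Unit using (tt)
open import Function using (_∘_; Equivalence)
open import Relation.Nullary using (yes; no)
open import Relation.Nullary.Decidable using (T?; ¬?)
open import Relation.Binary.PropositionalEquality

open FinSum +-0-commutativeMonoid using (∑-comm; ∑-distrib-+; sum-cong-≗; sum-syntax)
  renaming (sum to ∑)

-- Counting and finite sums
𝟙 : Bool → ℕ
𝟙 true  = 1
𝟙 false = 0

count≡sum𝟙 : ∀ {A : Set} (p : A → Bool) xs → count p xs ≡ sum (map (𝟙 ∘ p) xs)
count≡sum𝟙 p []       = refl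
count≡sum𝟙 p (x ∷ xs) with p x
... | true  = cong suc (count≡sum𝟙 p xs)
... | false = count≡sum𝟙 p xs

count-cong : ∀ {A : Set} {p q : A → Bool} → (∀ x → p x ≡ q x) → ∀ xs → count p xs ≡ count q xs
count-cong {p = p} {q} p≗q xs = trans (count≡sum𝟙 p xs) (trans (cong sum (map-cong (cong 𝟙 ∘ p≗q) xs)) (sym (count≡sum𝟙 q xs)))

count-++ : ∀ {A : Set} (p : A → Bool) xs ys → count p (xs ++ ys) ≡ count p xs ℕ.+ count p ys
count-++ p xs ys = trans (cong length (filter-++ (T? ∘ p) xs ys)) (length-++ (filter (T? ∘ p) xs))

count-map : ∀ {A B : Set} (p : B → Bool) (f : A → B) xs → count p (map f xs) ≡ count (p ∘ f) xs
count-map p f xs = begin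
  count p (map f xs)              ≡⟨ count≡sum𝟙 p (map f xs) ⟩
  sum (map (𝟙 ∘ p) (map f xs))    ≡⟨ cong sum (map-∘ xs) ⟨
  sum (map (𝟙 ∘ p ∘ f) xs)        ≡⟨ count≡sum𝟙 (p ∘ f) xs ⟨
  count (p ∘ f) xs                ∎
  where open ≡-Reasoning

count-filter : ∀ {A : Set} (p q : A → Bool) xs → count p (filter (T? ∘ q) xs) ≡ count (λ x → q x ∧ p x) xs
count-filter p q []       = refl
count-filter p q (x ∷ xs) with q x
... | false = count-filter p q xs
... | true with p x
...   | true  = cong suc (count-filter p q xs)
...   | false = count-filter p q xs

count-concatMap : ∀ {A B : Set} (p : B → Bool) (f : A → List B) xs →
                  count p (concatMap f xs) ≡ sum (map (count p ∘ f) xs)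
count-concatMap p f []       = refl
count-concatMap p f (x ∷ xs) = trans (count-++ p (f x) (concatMap f xs)) (cong (count p (f x) ℕ.+_) (count-concatMap p f xs))

filter-true : ∀ {A : Set} (xs : List A) → filter (λ _ → T? true) xs ≡ xs
filter-true xs = filter-all (λ _ → T? true) (All.universal (λ _ → tt) xs)

sum-tabulate : ∀ {n} (f : Fin n → ℕ) → sum (tabulate f) ≡ ∑ f
sum-tabulate {zero}  f = refl
sum-tabulate {suc n} f = cong (f Fin.zero ℕ.+_) (sum-tabulate (f ∘ Fin.suc))

sum-allFin : ∀ {n} (f : Fin n → ℕ) → sum (map f (allFin n)) ≡ ∑[ i < n ] f i
sum-allFin f = trans (cong sum (map-tabulate (λ i → i) f)) (sum-tabulate f)

count-allFin : ∀ {n} (p : Fin n → Bool) → count p (allFin n) ≡ ∑[ i < n ] 𝟙 (p i)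
count-allFin p = trans (count≡sum𝟙 p (allFin _)) (sum-allFin (𝟙 ∘ p))

∑-const : ∀ n c → ∑[ i < n ] c ≡ n ℕ.* c
∑-const zero    c = refl
∑-const (suc n) c = cong (c ℕ.+_) (∑-const n c)

∑-mono-≤ : ∀ {n} {f g : Fin n → ℕ} → (∀ i → f i ℕ.≤ g i) → ∑[ i < n ] f i ℕ.≤ ∑[ i < n ] g i
∑-mono-≤ {zero}  f≤g = ℕ.z≤n
∑-mono-≤ {suc n} f≤g = ℕ.+-mono-≤ (f≤g Fin.zero) (∑-mono-≤ (f≤g ∘ Fin.suc))

-- The handshake lemma
<ᵇ≡true⇒< : ∀ {m k} → (m <ᵇ k) ≡ true → m < k
<ᵇ≡true⇒< {m} {k} eq = ℕ.<ᵇ⇒< m k (subst T (sym eq) tt)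

<ᵇ≡false⇒≥ : ∀ {m k} → (m <ᵇ k) ≡ false → k ℕ.≤ m
<ᵇ≡false⇒≥ eq = ℕ.≮⇒≥ (λ m<k → subst T eq (ℕ.<⇒<ᵇ m<k))

module _ {n : ℕ} (f : Fin n → Fin n → Bool)
         (f-sym : ∀ u v → f u v ≡ f v u) (f-irrefl : ∀ v → f v v ≡ false) where

  private
    upper : Fin n → Fin n → ℕ
    upper u v = 𝟙 ((toℕ u <ᵇ toℕ v) ∧ f u v)

    𝟙-split-by-order : ∀ u v → 𝟙 (f u v) ≡ upper u v ℕ.+ upper v u
    𝟙-split-by-order u v with toℕ u <ᵇ toℕ v in u<v | toℕ v <ᵇ toℕ u in v<u
    ... | true  | true  = ⊥-elim (ℕ.<-asym (<ᵇ≡true⇒< {toℕ u} u<v) (<ᵇ≡true⇒< {toℕ v} v<u))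
    ... | true  | false = sym (ℕ.+-identityʳ _)
    ... | false | true  = cong 𝟙 (f-sym u v)
    ... | false | false = cong 𝟙 (trans (cong (f u) (sym u≡v)) (f-irrefl u))
      where u≡v = toℕ-injective (ℕ.≤-antisym (<ᵇ≡false⇒≥ {toℕ v} v<u) (<ᵇ≡false⇒≥ {toℕ u} u<v))

  handshake : ∑[ u < n ] ∑[ v < n ] 𝟙 (f u v) ≡ 2 ℕ.* ∑[ u < n ] ∑[ v < n ] 𝟙 ((toℕ u <ᵇ toℕ v) ∧ f u v)
  handshake = begin
    ∑[ u < n ] ∑[ v < n ] 𝟙 (f u v)                            ≡⟨ sum-cong-≗ (λ u → sum-cong-≗ (𝟙-split-by-order u)) ⟩
    ∑[ u < n ] ∑[ v < n ] (upper u v ℕ.+ upper v u)            ≡⟨ sum-cong-≗ (λ u → ∑-distrib-+ (upper u) (λ v → upper v u)) ⟩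
    ∑[ u < n ] (∑[ v < n ] upper u v ℕ.+ ∑[ v < n ] upper v u) ≡⟨ ∑-distrib-+ (λ u → ∑[ v < n ] upper u v) (λ u → ∑[ v < n ] upper v u) ⟩
    C ℕ.+ ∑[ u < n ] ∑[ v < n ] upper v u                      ≡⟨ cong (C ℕ.+_) (∑-comm (λ u v → upper v u)) ⟩
    C ℕ.+ C                                                    ≡⟨ cong (C ℕ.+_) (ℕ.+-identityʳ C) ⟨
    2 ℕ.* C                                                    ∎
    where
    open ≡-Reasoning
    C = ∑[ u < n ] ∑[ v < n ] upper u v

module _ {n T : ℕ} (G : TemporalGraph n T) (t : ℕ) where

  lab-irrefl : ∀ v → lab G v v t ≡ false
  lab-irrefl v with lab G v v t in e
  ... | false = refl
  ... | true  with () ← trans (sym (lab-edge G v v t e)) (edge-irrefl G v)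

  numEdges≡∑ : numEdges G t ≡ ∑[ u < n ] ∑[ v < n ] 𝟙 ((toℕ u <ᵇ toℕ v) ∧ lab G u v t)
  numEdges≡∑ = begin
    count P (concatMap row (allFin n))                  ≡⟨ count-concatMap P row (allFin n) ⟩
    sum (map (count P ∘ row) (allFin n))                ≡⟨ sum-allFin (count P ∘ row) ⟩
    ∑[ u < n ] count P (row u)                          ≡⟨ sum-cong-≗ count-row ⟩
    ∑[ u < n ] ∑[ v < n ] 𝟙 ((toℕ u <ᵇ toℕ v) ∧ lab G u v t) ∎
    where
    open ≡-Reasoning
    P : Fin n × Fin n → Bool
    P (u , v) = lab G u v t
    row : Fin n → List (Fin n × Fin n)
    row u = map (u ,_) (filter (λ v → T? (toℕ u <ᵇ toℕ v)) (allFin n))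
    count-row : ∀ u → count P (row u) ≡ ∑[ v < n ] 𝟙 ((toℕ u <ᵇ toℕ v) ∧ lab G u v t)
    count-row u = trans (count-map P (u ,_) (filter (λ v → T? (toℕ u <ᵇ toℕ v)) (allFin n)))
                 (trans (count-filter (λ v → lab G u v t) (λ v → toℕ u <ᵇ toℕ v) (allFin n))
                        (count-allFin (λ v → (toℕ u <ᵇ toℕ v) ∧ lab G u v t)))

  vol[V]≡2*numEdges : vol G t (λ _ → true) ≡ 2 ℕ.* numEdges G t
  vol[V]≡2*numEdges = begin
    sum (map (degree G t) (filter (λ _ → T? true) (allFin n))) ≡⟨ cong (sum ∘ map (degree G t)) (filter-true (allFin n)) ⟩
    sum (map (degree G t) (allFin n))                          ≡⟨ sum-allFin (degree G t) ⟩
    ∑[ v < n ] degree G t v                                    ≡⟨ sum-cong-≗ (λ v → count-allFin (λ u → lab G v u t)) ⟩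
    ∑[ u < n ] ∑[ v < n ] 𝟙 (lab G u v t)                      ≡⟨ handshake (λ u v → lab G u v t) (λ u v → lab-sym G u v t) lab-irrefl ⟩
    2 ℕ.* ∑[ u < n ] ∑[ v < n ] 𝟙 ((toℕ u <ᵇ toℕ v) ∧ lab G u v t) ≡⟨ cong (2 ℕ.*_) numEdges≡∑ ⟨
    2 ℕ.* numEdges G t                                         ∎
    where open ≡-Reasoning

toℚᵘ-fromℕ : ∀ k → toℚᵘ (fromℕ k) ℚᵘ.≃ mkℚᵘ (+ k) 0
toℚᵘ-fromℕ k = toℚᵘ-fromℚᵘ (mkℚᵘ (+ k) 0)

fromℕ-+ : ∀ x y → fromℕ (x ℕ.+ y) ≡ fromℕ x + fromℕ y
fromℕ-+ x y = toℚᵘ-injective (ℚᵘ.≃-trans (toℚᵘ-fromℕ (x ℕ.+ y)) (ℚᵘ.≃-trans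
  (*≡* (trans (cong (ℤ._* + 1) (ℤ.pos-+ x y)) (cross (+ x) (+ y))))
  (ℚᵘ.≃-sym (ℚᵘ.≃-trans (toℚᵘ-homo-+ (fromℕ x) (fromℕ y)) (ℚᵘ.+-cong (toℚᵘ-fromℕ x) (toℚᵘ-fromℕ y))))))
  where
  cross : ∀ a b → (a ℤ.+ b) ℤ.* + 1 ≡ (a ℤ.* + 1 ℤ.+ b ℤ.* + 1) ℤ.* + 1
  cross = ℤ.solve-∀

fromℕ-* : ∀ x y → fromℕ (x ℕ.* y) ≡ fromℕ x * fromℕ y
fromℕ-* x y = toℚᵘ-injective (ℚᵘ.≃-trans (toℚᵘ-fromℕ (x ℕ.* y)) (ℚᵘ.≃-trans
  (*≡* (cong (ℤ._* + 1) (ℤ.pos-* x y)))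
  (ℚᵘ.≃-sym (ℚᵘ.≃-trans (toℚᵘ-homo-* (fromℕ x) (fromℕ y)) (ℚᵘ.*-cong (toℚᵘ-fromℕ x) (toℚᵘ-fromℕ y))))))

0≤fromℕ : ∀ x → 0ℚ ≤ fromℕ x
0≤fromℕ x = nonNegative⁻¹ (fromℕ x) {{normalize-nonNeg x 1}}

fromℕ-mono-≤ : ∀ {x y} → x ℕ.≤ y → fromℕ x ≤ fromℕ y
fromℕ-mono-≤ {x} x≤y with z , refl ← ℕ.m≤n⇒∃[o]m+o≡n x≤y = begin
  fromℕ x             ≡⟨ +-identityʳ (fromℕ x) ⟨
  fromℕ x + 0ℚ        ≤⟨ +-monoʳ-≤ (fromℕ x) (0≤fromℕ z) ⟩
  fromℕ x + fromℕ z   ≡⟨ fromℕ-+ x z ⟨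
  fromℕ (x ℕ.+ z)     ∎
  where open ≤-Reasoning

1/d*d≡1 : ∀ d .{{_ : NonZero d}} → (+ 1 / d) * fromℕ d ≡ 1ℚ
1/d*d≡1 (suc k) = toℚᵘ-injective (ℚᵘ.≃-trans (toℚᵘ-homo-* (+ 1 / suc k) (fromℕ (suc k)))
  (ℚᵘ.≃-trans (ℚᵘ.*-cong (toℚᵘ-fromℚᵘ (mkℚᵘ (+ 1) k)) (toℚᵘ-fromℕ (suc k)))
              (*≡* (cong (λ m → + suc m) (ℕ.solve (k ∷ []))))))

[x*x]/x≡x : ∀ x .{{_ : NonZero x}} → + (x ℕ.* x) / x ≡ fromℕ x
[x*x]/x≡x x@(suc k) = toℚᵘ-injective (ℚᵘ.≃-trans (toℚᵘ-fromℚᵘ (mkℚᵘ (+ (x ℕ.* x)) k))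
  (ℚᵘ.≃-trans (*≡* (trans (ℤ.*-identityʳ _) (ℤ.pos-* x x))) (ℚᵘ.≃-sym (toℚᵘ-fromℕ x))))

sumℚ-++ : ∀ xs ys → sumℚ (xs ++ ys) ≡ sumℚ xs + sumℚ ys
sumℚ-++ []       ys = sym (+-identityˡ (sumℚ ys))
sumℚ-++ (x ∷ xs) ys = trans (cong (_+_ x) (sumℚ-++ xs ys)) (sym (+-assoc x (sumℚ xs) (sumℚ ys)))

sumℚ-mono-≤ : ∀ {A : Set} {f g : A → ℚ} {xs} → All (λ x → f x ≤ g x) xs → sumℚ (map f xs) ≤ sumℚ (map g xs)
sumℚ-mono-≤ All.[]              = ≤-refl
sumℚ-mono-≤ (fx≤gx All.∷ fxs≤gxs) = +-mono-≤ fx≤gx (sumℚ-mono-≤ fxs≤gxs)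

sumℚ-zero : ∀ {A : Set} {f : A → ℚ} → (∀ x → f x ≡ 0ℚ) → ∀ xs → sumℚ (map f xs) ≡ 0ℚ
sumℚ-zero f≡0 []       = refl
sumℚ-zero f≡0 (x ∷ xs) = trans (cong₂ _+_ (f≡0 x) (sumℚ-zero f≡0 xs)) (+-identityˡ 0ℚ)

sumUpTo-suc : ∀ k (f : ℕ → ℚ) → sumUpTo (suc k) f ≡ sumUpTo k f + f k
sumUpTo-suc k f = begin
  sumℚ (map f (upTo (suc k)))           ≡⟨ cong (sumℚ ∘ map f) (upTo-∷ʳ k) ⟨
  sumℚ (map f (upTo k ++ k ∷ []))       ≡⟨ cong sumℚ (map-++ f (upTo k) (k ∷ [])) ⟩
  sumℚ (map f (upTo k) ++ f k ∷ [])     ≡⟨ sumℚ-++ (map f (upTo k)) (f k ∷ []) ⟩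
  sumUpTo k f + (f k + 0ℚ)              ≡⟨ cong (_+_ (sumUpTo k f)) (+-identityʳ (f k)) ⟩
  sumUpTo k f + f k                     ∎
  where open ≡-Reasoning

-- Intervals of timesteps and restriction

-- range a b and the timesteps summed in loyalty π a b are, by definition,
-- interval a (suc b ∸ a) and interval a (b ∸ a).
interval : ℕ → ℕ → List ℕ
interval a k = map (a ℕ.+_) (upTo k)

applyUpTo-++ : ∀ {A : Set} (f : ℕ → A) k j → applyUpTo f (k ℕ.+ j) ≡ applyUpTo f k ++ applyUpTo (f ∘ (k ℕ.+_)) j
applyUpTo-++ f zero    j = refl
applyUpTo-++ f (suc k) j = cong (f 0 ∷_) (applyUpTo-++ (f ∘ suc) k j)

interval-++ : ∀ a k j → interval a (k ℕ.+ j) ≡ interval a k ++ interval (a ℕ.+ k) j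
interval-++ a k j = begin
  map (a ℕ.+_) (upTo (k ℕ.+ j))                                 ≡⟨ map-upTo (a ℕ.+_) (k ℕ.+ j) ⟩
  applyUpTo (a ℕ.+_) (k ℕ.+ j)                                  ≡⟨ applyUpTo-++ (a ℕ.+_) k j ⟩
  applyUpTo (a ℕ.+_) k ++ applyUpTo (λ i → a ℕ.+ (k ℕ.+ i)) j    ≡⟨ cong₂ _++_ (map-upTo (a ℕ.+_) k) shifted ⟨
  interval a k ++ interval (a ℕ.+ k) j                          ∎
  where
  open ≡-Reasoning
  shifted : interval (a ℕ.+ k) j ≡ applyUpTo (λ i → a ℕ.+ (k ℕ.+ i)) j
  shifted = trans (map-cong (ℕ.+-assoc a k) (upTo j)) (map-upTo (λ i → a ℕ.+ (k ℕ.+ i)) j)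

interval-split : ∀ {a m b} → a ℕ.≤ m → m ℕ.≤ b → interval a (b ∸ a) ≡ interval a (m ∸ a) ++ interval m (b ∸ m)
interval-split {a} a≤m m≤b with k , refl ← ℕ.m≤n⇒∃[o]m+o≡n a≤m | j , refl ← ℕ.m≤n⇒∃[o]m+o≡n m≤b = begin
  interval a (a ℕ.+ k ℕ.+ j ∸ a)                    ≡⟨ cong (interval a) (trans (cong (_∸ a) (ℕ.+-assoc a k j)) (ℕ.m+n∸m≡n a (k ℕ.+ j))) ⟩
  interval a (k ℕ.+ j)                              ≡⟨ interval-++ a k j ⟩
  interval a k ++ interval (a ℕ.+ k) j              ≡⟨ cong₂ (λ x y → interval a x ++ interval (a ℕ.+ k) y) (ℕ.m+n∸m≡n a k) (ℕ.m+n∸m≡n (a ℕ.+ k) j) ⟨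
  interval a (a ℕ.+ k ∸ a) ++ interval (a ℕ.+ k) (a ℕ.+ k ℕ.+ j ∸ (a ℕ.+ k)) ∎
  where open ≡-Reasoning

All-interval : ∀ a k → All (λ t → a ℕ.≤ t × t < a ℕ.+ k) (interval a k)
All-interval a k = subst (All _) (sym (map-upTo (a ℕ.+_) k))
  (applyUpTo⁺₁ (a ℕ.+_) k (λ {i} i<k → ℕ.m≤m+n a i , ℕ.+-monoʳ-< a i<k))

range-split : ∀ {a m b} → a ℕ.≤ suc m → m ℕ.≤ b → range a b ≡ range a m ++ range (suc m) b
range-split a≤1+m m≤b = interval-split a≤1+m (ℕ.s≤s m≤b)

snapshotTerm-cong : ∀ {n T₁ T₂} (G : TemporalGraph n T₁) (H : TemporalGraph n T₂) (π : Partition n) t →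
                    (∀ u v → lab G u v t ≡ lab H u v t) → snapshotTerm G π t ≡ snapshotTerm H π t
snapshotTerm-cong {n} G H π t lab≡ = cong sumℚ (map-cong term≡ (labelsAt π t))
  where
  edgesIn≡ : ∀ A → edgesIn G t A ≡ edgesIn H t A
  edgesIn≡ A = count-cong (λ (u , v) → cong (λ b → A u ∧ A v ∧ b) (lab≡ u v)) (pairs n)
  vol≡ : ∀ A → vol G t A ≡ vol H t A
  vol≡ A = cong sum (map-cong (λ v → count-cong (lab≡ v) (allFin n)) (filter (λ v → T? (A v)) (allFin n)))
  numEdges≡ : numEdges G t ≡ numEdges H t
  numEdges≡ = count-cong (λ (u , v) → lab≡ u v) (pairs n)
  term≡ : ∀ c → fromℕ (2 ℕ.* edgesIn G t (part π t c)) - volSqOver2m (vol G t (part π t c)) (numEdges G t)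
              ≡ fromℕ (2 ℕ.* edgesIn H t (part π t c)) - volSqOver2m (vol H t (part π t c)) (numEdges H t)
  term≡ c = cong₂ (λ e x → fromℕ (2 ℕ.* e) - x) (edgesIn≡ (part π t c)) (cong₂ volSqOver2m (vol≡ (part π t c)) numEdges≡)

≤ᵇ≡true : ∀ {m k} → m ℕ.≤ k → (m ℕ.≤ᵇ k) ≡ true
≤ᵇ≡true m≤k = Equivalence.to T-≡ (ℕ.≤⇒≤ᵇ m≤k)

lab-restrict : ∀ {n T} (G : TemporalGraph n T) {a b t} → a ℕ.≤ t → t ℕ.≤ b →
               ∀ u v → lab (restrict G a b) u v t ≡ lab G u v t
lab-restrict G {t = t} a≤t t≤b u v =
  trans (cong (lab G u v t ∧_) (cong₂ _∧_ (≤ᵇ≡true a≤t) (≤ᵇ≡true t≤b))) (∧-identityʳ (lab G u v t))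

qTilde-restrict : ∀ {n T} (G : TemporalGraph n T) ω {a b} π → a ℕ.≤ b →
                  qTilde (restrict G a b) ω a b π ≡ qTilde G ω a b π
qTilde-restrict G ω {a} {b} π a≤b =
  cong (λ s → sumℚ s + ω * fromℕ (loyalty π a b)) (map-cong-local (All.map agree (All-interval a (suc b ∸ a))))
  where
  agree : ∀ {t} → a ℕ.≤ t × t < a ℕ.+ (suc b ∸ a) → snapshotTerm (restrict G a b) π t ≡ snapshotTerm G π t
  agree {t} (a≤t , t<end) = snapshotTerm-cong (restrict G a b) G π t
    (lab-restrict G a≤t (ℕ.≤-pred (subst (t <_) (ℕ.m+[n∸m]≡n (ℕ.m≤n⇒m≤1+n a≤b)) t<end)))

-- Splitting the timeline
stays : ∀ {n} → Partition n → Fin n → ℕ → Bool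
stays π v t = π v t ℕ.≡ᵇ π v (suc t)

loyalty≡∑ : ∀ {n} (π : Partition n) a b → loyalty π a b ≡ ∑[ v < n ] count (stays π v) (interval a (b ∸ a))
loyalty≡∑ π a b = sum-allFin (λ v → count (stays π v) (interval a (b ∸ a)))

loyalty-split : ∀ {n} (π : Partition n) {a m b} → a ℕ.≤ m → m < b →
                loyalty π a b ℕ.≤ loyalty π a m ℕ.+ loyalty π (suc m) b ℕ.+ n
loyalty-split {n} π {a} {m} {b} a≤m m<b = begin
  loyalty π a b                                          ≡⟨ loyalty≡∑ π a b ⟩
  ∑[ v < n ] count (stays π v) (interval a (b ∸ a))     ≤⟨ ∑-mono-≤ per-vertex ⟩
  ∑[ v < n ] (before v ℕ.+ after v ℕ.+ 1)               ≡⟨ ∑-distrib-+ (λ v → before v ℕ.+ after v) (λ _ → 1) ⟩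
  ∑[ v < n ] (before v ℕ.+ after v) ℕ.+ ∑[ v < n ] 1    ≡⟨ cong₂ ℕ._+_ (∑-distrib-+ before after) (trans (∑-const n 1) (ℕ.*-identityʳ n)) ⟩
  ∑[ v < n ] before v ℕ.+ ∑[ v < n ] after v ℕ.+ n      ≡⟨ cong (λ x → x ℕ.+ n) (cong₂ ℕ._+_ (loyalty≡∑ π a m) (loyalty≡∑ π (suc m) b)) ⟨
  loyalty π a m ℕ.+ loyalty π (suc m) b ℕ.+ n           ∎
  where
  open ℕ.≤-Reasoning
  before after : Fin n → ℕ
  before v = count (stays π v) (interval a (m ∸ a))
  after  v = count (stays π v) (interval (suc m) (b ∸ suc m))
  boundary≤1 : ∀ v → count (stays π v) (interval m (suc m ∸ m)) ℕ.≤ 1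
  boundary≤1 v = ℕ.≤-trans (length-filter (T? ∘ stays π v) (interval m (suc m ∸ m)))
                  (ℕ.≤-reflexive (trans (length-map (m ℕ.+_) (upTo (suc m ∸ m)))
                                        (trans (length-upTo (suc m ∸ m)) (ℕ.m+n∸n≡m 1 m))))
  per-vertex : ∀ v → count (stays π v) (interval a (b ∸ a)) ℕ.≤ before v ℕ.+ after v ℕ.+ 1
  per-vertex v = begin
    count (stays π v) (interval a (b ∸ a))
      ≡⟨ cong (count (stays π v)) (trans (interval-split a≤m (ℕ.<⇒≤ m<b))
                                         (cong (interval a (m ∸ a) ++_) (interval-split (ℕ.n≤1+n m) m<b))) ⟩
    count (stays π v) (interval a (m ∸ a) ++ interval m (suc m ∸ m) ++ interval (suc m) (b ∸ suc m))
      ≡⟨ trans (count-++ (stays π v) (interval a (m ∸ a)) _)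
               (cong (before v ℕ.+_) (count-++ (stays π v) (interval m (suc m ∸ m)) _)) ⟩
    before v ℕ.+ (count (stays π v) (interval m (suc m ∸ m)) ℕ.+ after v)
      ≤⟨ ℕ.+-monoʳ-≤ (before v) (ℕ.+-monoˡ-≤ (after v) (boundary≤1 v)) ⟩
    before v ℕ.+ (1 ℕ.+ after v)
      ≡⟨ trans (ℕ.+-suc (before v) (after v)) (ℕ.+-comm 1 (before v ℕ.+ after v)) ⟩
    before v ℕ.+ after v ℕ.+ 1
      ∎

module _ {n T : ℕ} (G : TemporalGraph n T) {ω : ℚ} (0≤ω : 0ℚ ≤ ω) (π : Partition n) where

  private
    instance
      ω-nonNeg : ℚ.NonNegative ω
      ω-nonNeg = ℚ.nonNegative 0≤ω

    S : ℕ → ℕ → ℚ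
    S a b = sumℚ (map (snapshotTerm G π) (range a b))

  qTilde-split : ∀ {a m b} → a ℕ.≤ m → m < b →
                 qTilde G ω a b π ≤ qTilde G ω a m π + qTilde G ω (suc m) b π + ω * fromℕ n
  qTilde-split {a} {m} {b} a≤m m<b = begin
    S a b + ω * fromℕ L
      ≡⟨ cong (_+ ω * fromℕ L) snapshots-split ⟩
    S a m + S (suc m) b + ω * fromℕ L
      ≤⟨ +-monoʳ-≤ (S a m + S (suc m) b) (*-monoˡ-≤-nonNeg ω (fromℕ-mono-≤ (loyalty-split π a≤m m<b))) ⟩
    S a m + S (suc m) b + ω * fromℕ (L₁ ℕ.+ L₂ ℕ.+ n)
      ≡⟨ cong (λ x → S a m + S (suc m) b + ω * x) (trans (fromℕ-+ (L₁ ℕ.+ L₂) n) (cong (_+ fromℕ n) (fromℕ-+ L₁ L₂))) ⟩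
    S a m + S (suc m) b + ω * (fromℕ L₁ + fromℕ L₂ + fromℕ n)
      ≡⟨ solve 6 (λ s₁ s₂ w l₁ l₂ k → s₁ :+ s₂ :+ w :* (l₁ :+ l₂ :+ k) := s₁ :+ w :* l₁ :+ (s₂ :+ w :* l₂) :+ w :* k)
               refl (S a m) (S (suc m) b) ω (fromℕ L₁) (fromℕ L₂) (fromℕ n) ⟩
    (S a m + ω * fromℕ L₁) + (S (suc m) b + ω * fromℕ L₂) + ω * fromℕ n
      ∎
    where
    open ≤-Reasoning
    open +-*-Solver
    L  = loyalty π a b
    L₁ = loyalty π a m
    L₂ = loyalty π (suc m) b
    snapshots-split : S a b ≡ S a m + S (suc m) b
    snapshots-split = trans (cong (sumℚ ∘ map (snapshotTerm G π)) (range-split (ℕ.m≤n⇒m≤1+n a≤m) (ℕ.<⇒≤ m<b)))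
                            (trans (cong sumℚ (map-++ (snapshotTerm G π) (range a m) (range (suc m) b)))
                                   (sumℚ-++ (map (snapshotTerm G π) (range a m)) (map (snapshotTerm G π) (range (suc m) b))))

  qTilde-≤-blocks : (t : ℕ → ℕ) → t 0 ≡ 0 → ∀ k → (∀ j → j < k → t j < t (suc j)) →
                    qTilde G ω 1 (t k) π ≤ sumUpTo k (λ i → qTilde G ω (suc (t i)) (t (suc i)) π) + ω * fromℕ (n ℕ.* (k ∸ 1))
  qTilde-≤-blocks t t₀≡0 zero _ = ≤-reflexive (begin
    qTilde G ω 1 (t 0) π
      ≡⟨ cong (λ b → qTilde G ω 1 b π) t₀≡0 ⟩
    sumℚ (map (snapshotTerm G π) (range 1 0)) + ω * fromℕ (loyalty π 1 0)
      -- compared summand by summand: ℚ's _+_ unfolds by record η, so a whole-sum comparison is very slow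
      ≡⟨ cong₂ _+_ {x = sumℚ (map (snapshotTerm G π) (range 1 0))} {y = sumUpTo 0 W} refl
                   (cong (λ L → ω * fromℕ L) (trans (loyalty≡∑ π 1 0) (∑-const n 0))) ⟩
    sumUpTo 0 W + ω * fromℕ (n ℕ.* (0 ∸ 1))
      ∎)
    where
    open ≡-Reasoning
    W : ℕ → ℚ
    W i = qTilde G ω (suc (t i)) (t (suc i)) π
  qTilde-≤-blocks t t₀≡0 (suc zero) _ = ≤-reflexive (begin
    qTilde G ω 1 (t 1) π                              ≡⟨ cong (λ a → qTilde G ω (suc a) (t 1) π) t₀≡0 ⟨
    W 0                                               ≡⟨ +-identityʳ (W 0) ⟨
    W 0 + 0ℚ                                          ≡⟨ +-identityʳ (W 0 + 0ℚ) ⟨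
    W 0 + 0ℚ + 0ℚ                                     ≡⟨ cong (_+_ (W 0 + 0ℚ)) no-loss ⟨
    sumUpTo 1 W + ω * fromℕ (n ℕ.* (1 ∸ 1))           ∎)
    where
    open ≡-Reasoning
    W : ℕ → ℚ
    W i = qTilde G ω (suc (t i)) (t (suc i)) π
    no-loss : ω * fromℕ (n ℕ.* 0) ≡ 0ℚ
    no-loss = trans (cong (λ L → ω * fromℕ L) (ℕ.*-zeroʳ n)) (*-zeroʳ ω)
  qTilde-≤-blocks t t₀≡0 (suc (suc k)) increasing = begin
    qTilde G ω 1 (t (suc (suc k))) π
      ≤⟨ qTilde-split (ℕ.<-≤-trans (ℕ.s≤s ℕ.z≤n) (increasing k (ℕ.<-trans (ℕ.n<1+n k) (ℕ.n<1+n (suc k)))))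
                                (increasing (suc k) (ℕ.n<1+n (suc k))) ⟩
    qTilde G ω 1 (t (suc k)) π + W (suc k) + ω * fromℕ n
      ≤⟨ +-monoˡ-≤ (ω * fromℕ n) (+-monoˡ-≤ (W (suc k)) (qTilde-≤-blocks t t₀≡0 (suc k) (λ j j<1+k → increasing j (ℕ.<-trans j<1+k (ℕ.n<1+n (suc k)))))) ⟩
    sumUpTo (suc k) W + ω * fromℕ (n ℕ.* (suc k ∸ 1)) + W (suc k) + ω * fromℕ n
      ≡⟨ solve 4 (λ s x w y → s :+ x :+ w :+ y := s :+ w :+ (y :+ x)) refl (sumUpTo (suc k) W) (ω * fromℕ (n ℕ.* (suc k ∸ 1))) (W (suc k)) (ω * fromℕ n) ⟩
    sumUpTo (suc k) W + W (suc k) + (ω * fromℕ n + ω * fromℕ (n ℕ.* (suc k ∸ 1)))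
      ≡⟨ cong₂ _+_ (sumUpTo-suc (suc k) W) (trans (cong (λ L → ω * fromℕ L) (ℕ.*-suc n k)) (trans (cong (ω *_) (fromℕ-+ n (n ℕ.* k))) (*-distribˡ-+ ω (fromℕ n) (fromℕ (n ℕ.* k))))) ⟨
    sumUpTo (suc (suc k)) W + ω * fromℕ (n ℕ.* (suc (suc k) ∸ 1))
      ∎
    where
    open ≤-Reasoning
    open +-*-Solver
    W : ℕ → ℚ
    W i = qTilde G ω (suc (t i)) (t (suc i)) π

-- The partition with a single part
onePart : ∀ {n} → Partition n
onePart _ _ = 0

labelsAt-onePart : ∀ {n} t → labelsAt (onePart {suc n}) t ≡ 0 ∷ []
labelsAt-onePart {n} t = cong (0 ∷_) (no-other-label (tabulate {n = n} Fin.suc))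
  where
  no-other-label : ∀ {A : Set} (xs : List A) →
                   filter (λ c → ¬? (0 ℕ.≟ c)) (deduplicate ℕ._≟_ (map (λ _ → 0) xs)) ≡ []
  no-other-label []       = refl
  no-other-label (x ∷ xs) = cong (filter (λ c → ¬? (0 ℕ.≟ c))) (no-other-label xs)

2m-[2m]²/2m≡0 : ∀ m → fromℕ (2 ℕ.* m) - volSqOver2m (2 ℕ.* m) m ≡ 0ℚ
2m-[2m]²/2m≡0 zero       = refl
2m-[2m]²/2m≡0 m@(suc _) = trans (cong (λ x → fromℕ (2 ℕ.* m) - x) ([x*x]/x≡x (2 ℕ.* m))) (+-inverseʳ (fromℕ (2 ℕ.* m)))

snapshotTerm-onePart : ∀ {n T} (G : TemporalGraph n T) t → snapshotTerm G onePart t ≡ 0ℚ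
snapshotTerm-onePart {zero}  G t = refl
snapshotTerm-onePart {suc n} G t = begin
  sumℚ (map wholeTerm (labelsAt π t))                                   ≡⟨ cong (sumℚ ∘ map wholeTerm) (labelsAt-onePart {n} t) ⟩
  wholeTerm 0 + 0ℚ                                                       ≡⟨ +-identityʳ (wholeTerm 0) ⟩
  wholeTerm 0                                                            ≡⟨ cong₂ (λ e v → fromℕ (2 ℕ.* e) - volSqOver2m v m)
                                                                                  {x = edgesIn G t (part π t 0)} {y = m} {u = vol G t (part π t 0)} {v = 2 ℕ.* m}
                                                                                  refl (vol[V]≡2*numEdges G t) ⟩
  fromℕ (2 ℕ.* m) - volSqOver2m (2 ℕ.* m) m                              ≡⟨ 2m-[2m]²/2m≡0 m ⟩
  0ℚ                                                                     ∎
  where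
  open ≡-Reasoning
  π = onePart {suc n}
  m = numEdges G t
  wholeTerm : ℕ → ℚ
  wholeTerm c = fromℕ (2 ℕ.* edgesIn G t (part π t c)) - volSqOver2m (vol G t (part π t c)) m

loyalty-onePart : ∀ {n} a b → loyalty (onePart {n}) a b ≡ n ℕ.* (b ∸ a)
loyalty-onePart {n} a b = begin
  loyalty (onePart {n}) a b                                  ≡⟨ loyalty≡∑ (onePart {n}) a b ⟩
  ∑[ v < n ] count (λ _ → true) (interval a (b ∸ a))         ≡⟨ ∑-const n (count (λ _ → true) (interval a (b ∸ a))) ⟩
  n ℕ.* count (λ _ → true) (interval a (b ∸ a))              ≡⟨ cong (n ℕ.*_) count-true ⟩
  n ℕ.* (b ∸ a)                                              ∎
  where
  open ≡-Reasoning
  count-true : count (λ _ → true) (interval a (b ∸ a)) ≡ b ∸ a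
  count-true = trans (cong length (filter-true (interval a (b ∸ a))))
                     (trans (length-map (a ℕ.+_) (upTo (b ∸ a))) (length-upTo (b ∸ a)))

qTilde-onePart : ∀ {n T} (G : TemporalGraph n T) ω a b → qTilde G ω a b onePart ≡ ω * fromℕ (n ℕ.* (b ∸ a))
qTilde-onePart {n} G ω a b = begin
  sumℚ (map (snapshotTerm G (onePart {n})) (range a b)) + ω * fromℕ (loyalty (onePart {n}) a b)
    ≡⟨ cong₂ (λ s L → s + ω * fromℕ L) (sumℚ-zero (snapshotTerm-onePart G) (range a b)) (loyalty-onePart {n} a b) ⟩
  0ℚ + ω * fromℕ (n ℕ.* (b ∸ a))
    ≡⟨ +-identityˡ (ω * fromℕ (n ℕ.* (b ∸ a))) ⟩
  ω * fromℕ (n ℕ.* (b ∸ a))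
    ∎
  where open ≡-Reasoning

maxMod-≤-blocks : ∀ {n T} (G : TemporalGraph n T) {ω} → 0ℚ ≤ ω → (t : ℕ → ℕ) → t 0 ≡ 0 →
                  ∀ {ℓ} → t ℓ ≡ T → (∀ j → j < ℓ → t j < t (suc j)) →
                  ∀ {Q Qs} → IsMaxMod G ω 1 T Q →
                  (∀ i → i < ℓ → IsMaxMod (restrict G (suc (t i)) (t (suc i))) ω (suc (t i)) (t (suc i)) (Qs i)) →
                  Q ≤ sumUpTo ℓ Qs + ω * fromℕ (n ℕ.* (ℓ ∸ 1))
maxMod-≤-blocks {n} G {ω} 0≤ω t t₀≡0 {ℓ} t-ℓ increasing {Q} {Qs} ((π , qπ≡Q) , _) maxBlocks = begin
  Q                                ≡⟨ trans (sym qπ≡Q) (cong (λ b → qTilde G ω 1 b π) (sym t-ℓ)) ⟩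
  qTilde G ω 1 (t ℓ) π             ≤⟨ qTilde-≤-blocks G 0≤ω π t t₀≡0 ℓ increasing ⟩
  sumUpTo ℓ block + loss           ≤⟨ +-monoˡ-≤ loss (sumℚ-mono-≤ (applyUpTo⁺₁ (λ i → i) ℓ block≤Qs)) ⟩
  sumUpTo ℓ Qs + loss              ∎
  where
  open ≤-Reasoning
  loss = ω * fromℕ (n ℕ.* (ℓ ∸ 1))
  block : ℕ → ℚ
  block i = qTilde G ω (suc (t i)) (t (suc i)) π
  block≤Qs : ∀ {i} → i < ℓ → block i ≤ Qs i
  block≤Qs {i} i<ℓ = subst (_≤ Qs i) (qTilde-restrict G ω π (increasing i i<ℓ)) (proj₂ (maxBlocks i i<ℓ) π)

onePart-≤-maxMod : ∀ {n T} (G : TemporalGraph n T) {ω Q} → IsMaxMod G ω 1 T Q → ω * fromℕ (n ℕ.* (T ∸ 1)) ≤ Q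
onePart-≤-maxMod {T = T} G {ω} {Q} (_ , maximal) = subst (_≤ Q) (qTilde-onePart G ω 1 T) (maximal onePart)

-- Cut points
round-up-to-multiple : ∀ d → 1 ℕ.≤ d → ∀ T → Σ ℕ (λ ℓ → T ℕ.≤ ℓ ℕ.* d × ℓ ℕ.* d < T ℕ.+ d)
round-up-to-multiple d 1≤d zero = 0 , ℕ.z≤n , 1≤d
round-up-to-multiple d 1≤d (suc T) with ℓ , T≤ℓd , ℓd<T+d ← round-up-to-multiple d 1≤d T | suc T ℕ.≤? ℓ ℕ.* d
... | yes 1+T≤ℓd = ℓ , 1+T≤ℓd , ℕ.m<n⇒m<1+n ℓd<T+d
... | no  1+T≰ℓd = suc ℓ , subst (suc T ℕ.≤_) (cong (d ℕ.+_) (sym ℓd≡T)) (ℕ.+-monoˡ-≤ T 1≤d)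
                         , subst (λ x → d ℕ.+ x < suc T ℕ.+ d) (sym ℓd≡T) (ℕ.≤-reflexive (cong suc (ℕ.+-comm d T)))
  where
  ℓd≡T : ℓ ℕ.* d ≡ T
  ℓd≡T = ℕ.≤-antisym (ℕ.s≤s⁻¹ (ℕ.≰⇒> 1+T≰ℓd)) T≤ℓd

d*[ℓ∸1]≤T∸1 : ∀ {d T} ℓ → ℓ ℕ.* d < T ℕ.+ d → d ℕ.* (ℓ ∸ 1) ℕ.≤ T ∸ 1
d*[ℓ∸1]≤T∸1 {d}     zero    _      = ℕ.≤-trans (ℕ.≤-reflexive (ℕ.*-zeroʳ d)) ℕ.z≤n
d*[ℓ∸1]≤T∸1 {d} {T} (suc l) ℓd<T+d = subst (ℕ._≤ T ∸ 1) (ℕ.*-comm l d)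
  (ℕ.<⇒≤pred (ℕ.+-cancelˡ-< d (l ℕ.* d) T (subst (d ℕ.+ l ℕ.* d <_) (ℕ.+-comm T d) ℓd<T+d)))

d*[ω*n*[ℓ∸1]]≤ω*n*[T∸1] : ∀ {ω d T n} → 0ℚ ≤ ω → ∀ ℓ → ℓ ℕ.* d < T ℕ.+ d →
                          fromℕ d * (ω * fromℕ (n ℕ.* (ℓ ∸ 1))) ≤ ω * fromℕ (n ℕ.* (T ∸ 1))
d*[ω*n*[ℓ∸1]]≤ω*n*[T∸1] {ω} {d} {T} {n} 0≤ω ℓ ℓd<T+d = begin
  fromℕ d * (ω * fromℕ (n ℕ.* (ℓ ∸ 1)))    ≡⟨ solve 3 (λ d w x → d :* (w :* x) := w :* (d :* x)) refl (fromℕ d) ω (fromℕ (n ℕ.* (ℓ ∸ 1))) ⟩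
  ω * (fromℕ d * fromℕ (n ℕ.* (ℓ ∸ 1)))    ≡⟨ cong (ω *_) (fromℕ-* d (n ℕ.* (ℓ ∸ 1))) ⟨
  ω * fromℕ (d ℕ.* (n ℕ.* (ℓ ∸ 1)))        ≤⟨ *-monoˡ-≤-nonNeg ω (fromℕ-mono-≤ d*n*[ℓ∸1]≤n*[T∸1]) ⟩
  ω * fromℕ (n ℕ.* (T ∸ 1))                ∎
  where
  open ≤-Reasoning
  open +-*-Solver
  instance
    ω-nonNeg : ℚ.NonNegative ω
    ω-nonNeg = ℚ.nonNegative 0≤ω
  d*n*[ℓ∸1]≤n*[T∸1] : d ℕ.* (n ℕ.* (ℓ ∸ 1)) ℕ.≤ n ℕ.* (T ∸ 1)
  d*n*[ℓ∸1]≤n*[T∸1] = ℕ.≤-trans (ℕ.≤-reflexive (x∙yz≈y∙xz d n (ℓ ∸ 1))) (ℕ.*-monoʳ-≤ n (d*[ℓ∸1]≤T∸1 ℓ ℓd<T+d))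

module Cuts {d T : ℕ} (ℓ : ℕ) (1≤d : 1 ℕ.≤ d) (T≤ℓd : T ℕ.≤ ℓ ℕ.* d) (ℓd<T+d : ℓ ℕ.* d < T ℕ.+ d) where

  cut : ℕ → ℕ
  cut j = j ℕ.* d ℕ.⊓ T

  cut-ℓ : cut ℓ ≡ T
  cut-ℓ = ℕ.m≥n⇒m⊓n≡n T≤ℓd

  jd<T : ∀ j → j < ℓ → j ℕ.* d < T
  jd<T j j<ℓ = ℕ.+-cancelˡ-< d (j ℕ.* d) T (begin-strict
    d ℕ.+ j ℕ.* d   ≤⟨ ℕ.*-monoˡ-≤ d j<ℓ ⟩
    ℓ ℕ.* d         <⟨ ℓd<T+d ⟩
    T ℕ.+ d         ≡⟨ ℕ.+-comm T d ⟩
    d ℕ.+ T         ∎)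
    where open ℕ.≤-Reasoning

  cut-below-ℓ : ∀ j → j < ℓ → cut j ≡ j ℕ.* d
  cut-below-ℓ j j<ℓ = ℕ.m≤n⇒m⊓n≡m (ℕ.<⇒≤ (jd<T j j<ℓ))

  cut-< : ∀ j → j < ℓ → cut j < cut (suc j)
  cut-< j j<ℓ rewrite cut-below-ℓ j j<ℓ = ℕ.⊓-glb (ℕ.+-monoˡ-≤ (j ℕ.* d) 1≤d) (jd<T j j<ℓ)

  cut-gap : ∀ j → j < ℓ → cut (suc j) ∸ cut j ℕ.≤ d
  cut-gap j j<ℓ rewrite cut-below-ℓ j j<ℓ =
    ℕ.≤-trans (ℕ.∸-monoˡ-≤ (j ℕ.* d) (ℕ.m⊓n≤m (d ℕ.+ j ℕ.* d) T)) (ℕ.≤-reflexive (ℕ.m+n∸n≡m d (j ℕ.* d)))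

d*x≤Q⇒Q≤S+x⇒[1-1/d]*Q≤S : ∀ d .{{_ : NonZero d}} {Q S x} → fromℕ d * x ≤ Q → Q ≤ S + x → (1ℚ - + 1 / d) * Q ≤ S
d*x≤Q⇒Q≤S+x⇒[1-1/d]*Q≤S d {Q} {S} {x} dx≤Q Q≤S+x = begin
  (1ℚ - p) * Q   ≡⟨ solve 2 (λ p Q → (con 1ℚ :- p) :* Q := Q :- p :* Q) refl p Q ⟩
  Q - p * Q      ≤⟨ +-monoʳ-≤ Q (neg-antimono-≤ x≤pQ) ⟩
  Q - x          ≤⟨ +-monoˡ-≤ (- x) Q≤S+x ⟩
  S + x - x      ≡⟨ solve 2 (λ S x → S :+ x :- x := S) refl S x ⟩
  S              ∎
  where
  open ≤-Reasoning
  open +-*-Solver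
  p = + 1 / d
  instance
    p-nonNeg : ℚ.NonNegative p
    p-nonNeg = normalize-nonNeg 1 d
  x≤pQ : x ≤ p * Q
  x≤pQ = begin
    x                   ≡⟨ *-identityˡ x ⟨
    1ℚ * x              ≡⟨ cong (_* x) (1/d*d≡1 d) ⟨
    p * fromℕ d * x     ≡⟨ *-assoc p (fromℕ d) x ⟩
    p * (fromℕ d * x)   ≤⟨ *-monoˡ-≤-nonNeg p dx≤Q ⟩
    p * Q               ∎

lemma5 : {n T : ℕ} (G : TemporalGraph n T) (ω : ℚ) → 0ℚ ≤ ω →
         (d : ℕ) → .{{_ : NonZero d}} →
         Σ ℕ (λ ℓ → Σ (ℕ → ℕ) (λ t →
           (t 0 ≡ 0) × (t ℓ ≡ T)
           × ((j : ℕ) → j < ℓ → (t j < t (suc j)) × (t (suc j) ∸ t j ℕ.≤ 2 ℕ.* d))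
           × ((Q : ℚ) (Qs : ℕ → ℚ) →
              IsMaxMod G ω 1 T Q →
              ((i : ℕ) → i < ℓ →
                 IsMaxMod (restrict G (suc (t i)) (t (suc i))) ω (suc (t i)) (t (suc i)) (Qs i)) →
              (1ℚ - (+ 1 / d)) * Q ≤ sumUpTo ℓ Qs)))
lemma5 {n} {T} G ω 0≤ω d =
  ℓ , cut , refl , cut-ℓ , (λ j j<ℓ → cut-< j j<ℓ , ℕ.≤-trans (cut-gap j j<ℓ) (ℕ.m≤m+n d (d ℕ.+ 0))) , bound
  where
  1≤d = ℕ.>-nonZero⁻¹ d
  ℓ = proj₁ (round-up-to-multiple d 1≤d T)
  T≤ℓd = proj₁ (proj₂ (round-up-to-multiple d 1≤d T))
  ℓd<T+d = proj₂ (proj₂ (round-up-to-multiple d 1≤d T))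
  open Cuts ℓ 1≤d T≤ℓd ℓd<T+d
  bound : (Q : ℚ) (Qs : ℕ → ℚ) → IsMaxMod G ω 1 T Q →
          ((i : ℕ) → i < ℓ → IsMaxMod (restrict G (suc (cut i)) (cut (suc i))) ω (suc (cut i)) (cut (suc i)) (Qs i)) →
          (1ℚ - (+ 1 / d)) * Q ≤ sumUpTo ℓ Qs
  bound Q Qs maxQ maxBlocks = d*x≤Q⇒Q≤S+x⇒[1-1/d]*Q≤S d
    (≤-trans (d*[ω*n*[ℓ∸1]]≤ω*n*[T∸1] {n = n} 0≤ω ℓ ℓd<T+d) (onePart-≤-maxMod G {ω} maxQ))
    (maxMod-≤-blocks G 0≤ω cut refl cut-ℓ cut-< maxQ maxBlocks)
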